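{- Let $n\ge 4$ be a composite integer and let $T=|V(\mathcal{E}_{\mathbb{Z}_n})|$. Then $\dim(\mathcal{E}_{\mathbb{Z}_n})=T-1$ if and only if either $n=p^m$ for a prime $p$ and $m>1$, or $n=p_1p_2$ for distinct primes $p_1,p_2$.
   Context: An ideal of a commutative ring $R$ with unity is essential if it has nonzero intersection with every nonzero ideal of $R$. The essential ideal graph $\mathcal{E}_{R}$ is the simple graph whose vertices are the nonzero proper ideals of $R$, distinct $\hat I,\hat J$ adjacent iff $\hat I+\hat J$ is essential. For an ordered set $W=\{w_1,\dots,w_t\}$ of vertices of a connected graph $\Gamma$ and a vertex $v$, $r(v\mid W)=(d(v,w_1),\dots,d(v,w_t))$ with $d$ the graph distance; $W$ is resolving if $r(u\mid W)\ne r(v\mid W)$ for all distinct $u,v\notin W$. The metric dimension $\dim(\Gamma)$ is the minimum size of a resolving set. -}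

module Defs where

open import Level using (0ℓ)
open import Data.Nat using (ℕ; zero; suc; _+_; _*_; _^_; _≤_; _<_; _<?_)
open import Data.Nat.Divisibility using (_∣_; _∣?_)
open import Data.Nat.Primality using (Prime)
open import Data.Product using (Σ; ∃; ∃-syntax; _×_; _,_)
open import Data.Sum using (_⊎_)
open import Data.List using (List; []; _∷_; length; filter; upTo)
open import Data.List.Relation.Unary.All using (All)
open import Data.List.Relation.Unary.Unique.Propositional using (Unique)
open import Data.List.Membership.Propositional using (_∈_; _∉_)
open import Relation.Binary.PropositionalEquality using (_≡_; _≢_)
open import Relation.Nullary using (Dec)
open import Relation.Nullary.Decidable using (_×-dec_)

-- Elements of ℤ_n are represented by residues x with x < n (x = 0 is the zero).
-- A subset of ℤ_n is a predicate on residues.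
SubsetZ : Set₁
SubsetZ = ℕ → Set

-- Every ideal of ℤ_n is d ℤ_n for a unique divisor d of n.
-- The ideal d ℤ_n (d ∣ n) as a subset of ℤ_n.
IdealGen : ℕ → SubsetZ
IdealGen d x = d ∣ x

SumZ : ℕ → SubsetZ → SubsetZ → SubsetZ
SumZ n I J x = ∃[ a ] ∃[ b ] ∃[ q ] (a < n × b < n × I a × J b × a + b ≡ x + q * n)

-- I is essential in ℤ_n: nonzero intersection with every nonzero ideal e ℤ_n
-- (e ∣ n, e ≢ n; e = n gives the zero ideal).
Essential : ℕ → SubsetZ → Set
Essential n I = ∀ e → e ∣ n → e ≢ n →
  ∃[ x ] (x < n × x ≢ 0 × I x × IdealGen e x)

-- Vertices of E(ℤ_n): nonzero proper ideals d ℤ_n, i.e. divisors d with 1 < d < n.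
Vertex : ℕ → ℕ → Set
Vertex n d = d ∣ n × 1 < d × d < n

vertex? : ∀ n d → Dec (Vertex n d)
vertex? n d = (d ∣? n) ×-dec ((1 <? d) ×-dec (d <? n))

VertexCount : ℕ → ℕ
VertexCount n = length (filter (vertex? n) (upTo (suc n)))

Adj : ℕ → ℕ → ℕ → Set
Adj n d e = Vertex n d × Vertex n e × d ≢ e ×
  Essential n (SumZ n (IdealGen d) (IdealGen e))

data Walk (n : ℕ) : ℕ → ℕ → ℕ → Set where
  here : ∀ {u} → Vertex n u → Walk n u u 0
  step : ∀ {u w v k} → Adj n u w → Walk n w v k → Walk n u v (suc k)

Dist : ℕ → ℕ → ℕ → ℕ → Set
Dist n u v k = Walk n u v k × (∀ j → Walk n u v j → k ≤ j)

Resolving : ℕ → List ℕ → Set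
Resolving n W = All (Vertex n) W ×
  (∀ u v → Vertex n u → Vertex n v → u ≢ v → u ∉ W → v ∉ W →
    ∃[ w ] (w ∈ W × ∃[ a ] ∃[ b ] (Dist n u w a × Dist n v w b × a ≢ b)))

MetricDim : ℕ → ℕ → Set
MetricDim n k =
  (∃[ W ] (Unique W × Resolving n W × length W ≡ k)) ×
  (∀ W → Unique W → Resolving n W → k ≤ length W)

PrimePowerOrTwoPrimes : ℕ → Set
PrimePowerOrTwoPrimes n =
  (∃[ p ] ∃[ m ] (Prime p × 1 < m × n ≡ p ^ m)) ⊎
  (∃[ p ] ∃[ q ] (Prime p × Prime q × p ≢ q × n ≡ p * q))

module Submission where

-- A complete graph on T vertices has metric dimension T − 1: dropping one vertex leaves a resolving set,
-- while two vertices outside a resolving set W would be at distance 1 from every vertex of W.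
-- If instead the graph has an induced path v − u − w, then w is at distance 1 from u and 2 from v,
-- so all vertices but u and v already resolve, and the dimension is at most T − 2.
-- E(ℤ_n) is complete for n = p^(1+k), since every proper divisor of n divides p^k, and for n = pq,
-- whose only vertices are p and q. Any other composite n is p^(2+a) s with p ∤ s > 1, where s − p − ps
-- is an induced path (p ℤ_n is essential because p² ∣ n), or p q t with p ∤ qt and t > 1, where
-- p − t − pq is one. Non-adjacency comes from a coprime splitting n = g e with g dividing both ends:
-- their ideal sum lies in g ℤ_n, which meets e ℤ_n only in 0.

open import Defs
open import Data.Nat using (ℕ; zero; suc; _+_; _*_; _^_; _≤_; _<_; _∸_; _≟_; z≤n; s≤s; z<s;
  >-nonZero; >-nonZero⁻¹; ≢-nonZero; ≢-nonZero⁻¹; nonTrivial⇒n>1)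
open import Data.Nat.Properties
open import Data.Nat.Divisibility
open import Data.Nat.Coprimality as Coprime using (Coprime; coprime-divisor)
open import Data.Nat.Primality
open import Data.Nat.Primality.Factorisation using (factorise)
open import Data.Nat.ListAction using (product)
open import Data.Nat.Induction using (<-rec)
open import Data.Nat.Tactic.RingSolver using (solve-∀)
open import Data.Product using (∃-syntax; _×_; _,_; proj₁; proj₂)
open import Data.Sum using (_⊎_; inj₁; inj₂)
open import Data.Empty using (⊥-elim)
open import Data.List using (List; []; _∷_; length; filter; upTo; drop)
open import Data.List.Properties using (length-drop; filter-notAll)
open import Data.List.Relation.Unary.All as All using (All; _∷_; all?)
open import Data.List.Relation.Unary.All.Properties using (¬All⇒Any¬) renaming (drop⁺ to All-drop⁺)
open import Data.List.Relation.Unary.Any as Any using (here; there)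
open import Data.List.Relation.Unary.AllPairs using (_∷_)
open import Data.List.Relation.Unary.Unique.Propositional using (Unique)
import Data.List.Relation.Unary.Unique.Propositional.Properties as Unique
open import Data.List.Relation.Binary.Subset.Propositional using (_⊆_)
open import Data.List.Membership.Propositional using (_∈_; _∉_; find)
open import Data.List.Membership.Propositional.Properties using (∈-filter⁺; ∈-filter⁻; ∈-upTo⁺)
open import Function using (_∘_)
open import Function.Bundles using (_⇔_; mk⇔)
open import Relation.Binary.Definitions using (DecidableEquality)
open import Relation.Binary.PropositionalEquality using (_≡_; _≢_; refl; sym; trans; cong; subst)
open import Relation.Nullary using (¬_; Dec; yes; no; ¬?)
open import Relation.Nullary.Decidable using (_×-dec_)

private
  variable
    c d e g k m n p q s t u v w x : ℕ

module _ {A : Set} (_≟_ : DecidableEquality A) where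
  open import Data.List.Membership.DecPropositional _≟_ using (_∈?_)

  length-mono-⊆ : ∀ {xs ys : List A} → Unique xs → xs ⊆ ys → length xs ≤ length ys
  length-mono-⊆ {[]} _ _ = z≤n
  length-mono-⊆ {x ∷ xs} {ys} (x≢xs ∷ xs-unique) xs⊆ys =
    ≤-trans (s≤s (length-mono-⊆ xs-unique xs⊆ys∖x)) (filter-notAll ≢x? ys ¬≢x-in-ys)
    where
    ≢x? : ∀ y → Dec (y ≢ x)
    ≢x? y = ¬? (y ≟ x)
    ¬≢x-in-ys : Any.Any (λ y → ¬ y ≢ x) ys
    ¬≢x-in-ys = Any.map (λ x≡y y≢x → y≢x (sym x≡y)) (xs⊆ys (here refl))
    xs⊆ys∖x : xs ⊆ filter ≢x? ys
    xs⊆ys∖x y∈xs = ∈-filter⁺ ≢x? (xs⊆ys (there y∈xs)) (λ y≡x → All.lookup x≢xs y∈xs (sym y≡x))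

  length∸1≤-of-≤1-outside : ∀ {xs W : List A} → Unique xs →
    (∀ {y z} → y ∈ xs → z ∈ xs → y ∉ W → z ∉ W → y ≡ z) → length xs ∸ 1 ≤ length W
  length∸1≤-of-≤1-outside {xs} {W} xs-unique ≤1-outside with all? (_∈? W) xs
  ... | yes xs⊆W = ≤-trans (m∸n≤m (length xs) 1) (length-mono-⊆ xs-unique (All.lookup xs⊆W))
  ... | no xs⊈W with find (¬All⇒Any¬ (_∈? W) xs xs⊈W)
  ...   | y , y∈xs , y∉W = ∸-monoˡ-≤ 1 (length-mono-⊆ xs-unique xs⊆y∷W)
    where
    xs⊆y∷W : xs ⊆ y ∷ W
    xs⊆y∷W {z} z∈xs with z ∈? W
    ... | yes z∈W = there z∈W
    ... | no z∉W = here (≤1-outside z∈xs y∈xs z∉W y∉W)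

∉-drop1⇒≡ : ∀ {A : Set} {xs : List A} {y z : A} →
  y ∈ xs → z ∈ xs → y ∉ drop 1 xs → z ∉ drop 1 xs → y ≡ z
∉-drop1⇒≡ (here refl) (here refl) _ _ = refl
∉-drop1⇒≡ (there y∈) _ y∉ _ = ⊥-elim (y∉ y∈)
∉-drop1⇒≡ _ (there z∈) _ z∉ = ⊥-elim (z∉ z∈)

-- Distances and resolving sets in E(ℤ_n)

sum-comm : ∀ {I J : SubsetZ} → SumZ n I J x → SumZ n J I x
sum-comm (a , b , q , a<n , b<n , a∈I , b∈J , a+b≡x+qn) =
  b , a , q , b<n , a<n , b∈J , a∈I , trans (+-comm b a) a+b≡x+qn

essential-mono : ∀ {I J : SubsetZ} → (∀ {x} → I x → J x) → Essential n I → Essential n J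
essential-mono I⊆J I-essential e e∣n e≢n with I-essential e e∣n e≢n
... | x , x<n , x≢0 , x∈I , e∣x = x , x<n , x≢0 , I⊆J x∈I , e∣x

adj-sym : Adj n u v → Adj n v u
adj-sym (vu , vv , u≢v , essential) = vv , vu , u≢v ∘ sym , essential-mono sum-comm essential

vertices : ℕ → List ℕ
vertices n = filter (vertex? n) (upTo (suc n))

∈-vertices⁺ : Vertex n d → d ∈ vertices n
∈-vertices⁺ {n} vd@(_ , _ , d<n) = ∈-filter⁺ (vertex? n) (∈-upTo⁺ (m≤n⇒m≤1+n d<n)) vd

∈-vertices⁻ : d ∈ vertices n → Vertex n d
∈-vertices⁻ {n = n} d∈ = proj₂ (∈-filter⁻ (vertex? n) {xs = upTo (suc n)} d∈)

vertices-unique : ∀ n → Unique (vertices n)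
vertices-unique n = Unique.filter⁺ (vertex? n) (Unique.upTo⁺ (suc n))

dist-unique : ∀ {i j} → Dist n u v i → Dist n u v j → i ≡ j
dist-unique (walk-i , shortest-i) (walk-j , shortest-j) = ≤-antisym (shortest-i _ walk-j) (shortest-j _ walk-i)

dist-adj : Adj n u v → Dist n u v 1
dist-adj {n} {u} {v} uv@(_ , vv , u≢v , _) = step uv (here vv) , shortest
  where
  shortest : ∀ j → Walk n u v j → 1 ≤ j
  shortest zero (here _) = ⊥-elim (u≢v refl)
  shortest (suc _) _ = s≤s z≤n

dist-two : Adj n u w → Adj n w v → u ≢ v → ¬ Adj n u v → Dist n u v 2
dist-two {n} {u} {w} {v} uw wv@(_ , vv , _) u≢v ¬uv = step uw (step wv (here vv)) , shortest
  where
  shortest : ∀ j → Walk n u v j → 2 ≤ j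
  shortest zero (here _) = ⊥-elim (u≢v refl)
  shortest (suc zero) (step uv (here _)) = ⊥-elim (¬uv uv)
  shortest (suc (suc _)) _ = s≤s (s≤s z≤n)

drop1-resolving : ∀ n → Resolving n (drop 1 (vertices n))
drop1-resolving n = All-drop⁺ 1 (All.tabulate ∈-vertices⁻) ,
  λ u v vu vv u≢v u∉ v∉ → ⊥-elim (u≢v (∉-drop1⇒≡ (∈-vertices⁺ vu) (∈-vertices⁺ vv) u∉ v∉))

resolving-of-two-outside : ∀ {W i j} → All (Vertex n) W → (∀ {z} → Vertex n z → z ∉ W → z ≡ u ⊎ z ≡ v) →
  w ∈ W → Dist n u w i → Dist n v w j → i ≢ j → Resolving n W
resolving-of-two-outside {n} {u} {v} {w} {W} {i} {j} all-vertices outside w∈W du dv i≢j = all-vertices , separate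
  where
  separate : ∀ x y → Vertex n x → Vertex n y → x ≢ y → x ∉ W → y ∉ W →
    ∃[ w′ ] (w′ ∈ W × ∃[ a ] ∃[ b ] (Dist n x w′ a × Dist n y w′ b × a ≢ b))
  separate x y vx vy x≢y x∉ y∉ with outside vx x∉ | outside vy y∉
  ... | inj₁ refl | inj₁ refl = ⊥-elim (x≢y refl)
  ... | inj₁ refl | inj₂ refl = w , w∈W , i , j , du , dv , i≢j
  ... | inj₂ refl | inj₁ refl = w , w∈W , j , i , dv , du , i≢j ∘ sym
  ... | inj₂ refl | inj₂ refl = ⊥-elim (x≢y refl)

Complete : ℕ → Set
Complete n = ∀ {u v} → Vertex n u → Vertex n v → u ≢ v → Adj n u v

complete⇒resolving-size : Complete n → ∀ {W} → Resolving n W → VertexCount n ∸ 1 ≤ length W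
complete⇒resolving-size {n} complete {W} (all-vertices , separate) =
  length∸1≤-of-≤1-outside _≟_ (vertices-unique n) ≤1-outside
  where
  ≤1-outside : ∀ {u v} → u ∈ vertices n → v ∈ vertices n → u ∉ W → v ∉ W → u ≡ v
  ≤1-outside {u} {v} u∈ v∈ u∉W v∉W with u ≟ v
  ... | yes u≡v = u≡v
  ... | no u≢v with separate u v (∈-vertices⁻ u∈) (∈-vertices⁻ v∈) u≢v u∉W v∉W
  ...   | w , w∈W , i , j , du , dv , i≢j =
    ⊥-elim (i≢j (trans (at-distance-one u∈ u∉W du) (sym (at-distance-one v∈ v∉W dv))))
    where
    at-distance-one : ∀ {z k} → z ∈ vertices n → z ∉ W → Dist n z w k → k ≡ 1
    at-distance-one z∈ z∉W dz =
      let z≢w = λ { refl → z∉W w∈W }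
      in dist-unique dz (dist-adj (complete (∈-vertices⁻ z∈) (All.lookup all-vertices w∈W) z≢w))

complete⇒metricDim : Complete n → MetricDim n (VertexCount n ∸ 1)
complete⇒metricDim {n} complete =
  (drop 1 (vertices n) , Unique.drop⁺ 1 (vertices-unique n) , drop1-resolving n , length-drop 1 (vertices n)) ,
  λ _ _ → complete⇒resolving-size complete

induced-path⇒¬metricDim : Adj n u v → Adj n u w → ¬ Adj n v w → v ≢ w → ¬ MetricDim n (VertexCount n ∸ 1)
induced-path⇒¬metricDim {n} {u} {v} {w} uv@(vu , vv , u≢v , _) uw@(_ , vw , u≢w , _) ¬vw v≢w (_ , minimal) =
  <⇒≱ W-small (minimal W W-unique W-resolving)
  where
  ∉uv? : ∀ z → Dec (z ≢ u × z ≢ v)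
  ∉uv? z = ¬? (z ≟ u) ×-dec ¬? (z ≟ v)
  W : List ℕ
  W = filter ∉uv? (vertices n)
  W-unique : Unique W
  W-unique = Unique.filter⁺ ∉uv? (vertices-unique n)
  W⁻ : ∀ {z} → z ∈ W → z ∈ vertices n × (z ≢ u × z ≢ v)
  W⁻ = ∈-filter⁻ ∉uv? {xs = vertices n}
  outside : ∀ {z} → Vertex n z → z ∉ W → z ≡ u ⊎ z ≡ v
  outside {z} vz z∉W with z ≟ u | z ≟ v
  ... | yes z≡u | _ = inj₁ z≡u
  ... | _ | yes z≡v = inj₂ z≡v
  ... | no z≢u | no z≢v = ⊥-elim (z∉W (∈-filter⁺ ∉uv? (∈-vertices⁺ vz) (z≢u , z≢v)))
  W-resolving : Resolving n W
  W-resolving =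
    resolving-of-two-outside (All.tabulate (∈-vertices⁻ ∘ proj₁ ∘ W⁻)) outside
      (∈-filter⁺ ∉uv? (∈-vertices⁺ vw) (u≢w ∘ sym , v≢w ∘ sym))
      (dist-adj uw) (dist-two (adj-sym uv) uw v≢w ¬vw) λ ()
  uvW-unique : Unique (u ∷ v ∷ W)
  uvW-unique = (u≢v ∷ All.tabulate (λ z∈W → proj₁ (proj₂ (W⁻ z∈W)) ∘ sym))
             ∷ All.tabulate (λ z∈W → proj₂ (proj₂ (W⁻ z∈W)) ∘ sym)
             ∷ W-unique
  uvW⊆vertices : u ∷ v ∷ W ⊆ vertices n
  uvW⊆vertices (here refl) = ∈-vertices⁺ vu
  uvW⊆vertices (there (here refl)) = ∈-vertices⁺ vv
  uvW⊆vertices (there (there z∈W)) = proj₁ (W⁻ z∈W)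
  W-small : length W < VertexCount n ∸ 1
  W-small = ∸-monoˡ-≤ 1 (length-mono-⊆ _≟_ uvW-unique uvW⊆vertices)

prime>1 : Prime p → 1 < p
prime>1 {p} p-prime = nonTrivial⇒n>1 p {{prime⇒nonTrivial p-prime}}

prime∤⇒coprime : Prime p → ¬ p ∣ n → Coprime p n
prime∤⇒coprime p-prime p∤n (d∣p , d∣n) with prime⇒irreducible p-prime d∣p
... | inj₁ d≡1 = d≡1
... | inj₂ refl = ⊥-elim (p∤n d∣n)

∤⇒≢ : ¬ d ∣ n → d ≢ n
∤⇒≢ d∤n refl = d∤n ∣-refl

∣p*m∧p∤⇒∣m : Prime p → ¬ p ∣ d → d ∣ p * m → d ∣ m
∣p*m∧p∤⇒∣m p-prime p∤d = coprime-divisor (Coprime.sym (prime∤⇒coprime p-prime p∤d))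

coprime-^ˡ : ∀ k → Coprime m n → Coprime (m ^ k) n
coprime-^ˡ zero _ (d∣1 , _) = ∣1⇒≡1 d∣1
coprime-^ˡ (suc k) m⊥n (d∣m^1+k , d∣n) =
  coprime-^ˡ k m⊥n (coprime-divisor (λ (c∣d , c∣m) → m⊥n (c∣m , ∣-trans c∣d d∣n)) d∣m^1+k , d∣n)

coprime⇒*∣ : Coprime m n → m ∣ x → n ∣ x → m * n ∣ x
coprime⇒*∣ {m} {n} m⊥n (divides k refl) n∣km =
  let n∣k = coprime-divisor (Coprime.sym m⊥n) (subst (n ∣_) (*-comm k m) n∣km)
  in subst (m * n ∣_) (*-comm m k) (*-monoʳ-∣ m n∣k)

primeDivisor : 1 < n → ∃[ p ] (Prime p × p ∣ n)
primeDivisor {n} 1<n with factorise n {{>-nonZero (<-trans z<s 1<n)}}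
... | record { factors = [] ; isFactorisation = refl } = ⊥-elim (<-irrefl refl 1<n)
... | record { factors = p ∷ ps ; isFactorisation = refl ; factorsPrime = p-prime ∷ _ } =
  p , p-prime , m∣m*n (product ps)

p-adic-split : Prime p → ∀ n → 0 < n → ∃[ a ] ∃[ s ] (n ≡ p ^ a * s × ¬ p ∣ s)
p-adic-split {p} p-prime = <-rec _ split
  where
  instance _ = prime⇒nonZero p-prime
  split : ∀ n → (∀ {m} → m < n → 0 < m → ∃[ a ] ∃[ s ] (m ≡ p ^ a * s × ¬ p ∣ s)) →
          0 < n → ∃[ a ] ∃[ s ] (n ≡ p ^ a * s × ¬ p ∣ s)
  split n rec 0<n with p ∣? n
  ... | no p∤n = 0 , n , sym (*-identityˡ n) , p∤n
  ... | yes (divides zero refl) = ⊥-elim (<-irrefl refl 0<n)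
  ... | yes (divides m@(suc _) refl) with rec (m<m*n m p (prime>1 p-prime)) z<s
  ...   | a , s , m≡p^a*s , p∤s =
    suc a , s , trans (cong (_* p) m≡p^a*s) (trans (*-comm _ p) (sym (*-assoc p (p ^ a) s))) , p∤s

prime⊎prime*nontrivial : 1 < s → Prime s ⊎ ∃[ q ] ∃[ t ] (Prime q × 1 < t × s ≡ q * t)
prime⊎prime*nontrivial {s} 1<s with prime? s
... | yes s-prime = inj₁ s-prime
... | no ¬s-prime with primeDivisor 1<s
...   | q , q-prime , divides zero s≡0 = ⊥-elim (<⇒≢ (<-trans z<s 1<s) (sym s≡0))
...   | q , q-prime , divides 1 s≡q = ⊥-elim (¬s-prime (subst Prime (sym (trans s≡q (*-identityˡ q))) q-prime))
...   | q , q-prime , divides (suc (suc t)) s≡tq =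
  inj₂ (q , 2 + t , q-prime , s≤s (s≤s z≤n) , trans s≡tq (*-comm _ q))

ProperDivisor : ℕ → ℕ → Set
ProperDivisor n x = x ∣ n × x ≢ n

properDivisor⇒bounds : 0 < n → ProperDivisor n x → x < n × x ≢ 0
properDivisor⇒bounds 0<n (x∣n , x≢n) =
  ≤∧≢⇒< (∣⇒≤ {{>-nonZero 0<n}} x∣n) x≢n , λ { refl → x≢n (sym (0∣⇒≡0 x∣n)) }

cofactor-properDivisor : 1 < c → n ≡ c * x → 0 < n → ProperDivisor n x
cofactor-properDivisor {c} {x = x} 1<c refl 0<cx = n∣m*n c , λ x≡cx → <⇒≢ (x<cx x≡cx) x≡cx
  where
  x<cx : x ≡ c * x → x < c * x
  x<cx x≡cx = subst (x <_) (*-comm x c) (m<m*n x c {{>-nonZero (subst (0 <_) (sym x≡cx) 0<cx)}} 1<c)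

properDivisor-p^1+k⇒∣p^k : Prime p → ∀ k → ProperDivisor (p ^ suc k) d → d ∣ p ^ k
properDivisor-p^1+k⇒∣p^k {p} {d} p-prime zero (d∣p , d≢p)
  with prime⇒irreducible p-prime (subst (d ∣_) (*-identityʳ p) d∣p)
... | inj₁ refl = ∣-refl
... | inj₂ d≡p = ⊥-elim (d≢p (trans d≡p (sym (*-identityʳ p))))
properDivisor-p^1+k⇒∣p^k {p} {d} p-prime (suc k) (d∣p^2+k , d≢p^2+k) with p ∣? d
... | no p∤d = ∣p*m∧p∤⇒∣m p-prime p∤d d∣p^2+k
... | yes (divides d′ refl) =
  subst (d′ * p ∣_) (*-comm _ p) (*-monoˡ-∣ p (properDivisor-p^1+k⇒∣p^k p-prime k (d′∣p^1+k , d′≢p^1+k)))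
  where
  instance _ = prime⇒nonZero p-prime
  d′∣p^1+k : d′ ∣ p ^ suc k
  d′∣p^1+k = *-cancelʳ-∣ p (subst (d′ * p ∣_) (*-comm p _) d∣p^2+k)
  d′≢p^1+k : d′ ≢ p ^ suc k
  d′≢p^1+k d′≡p^1+k = d≢p^2+k (trans (cong (_* p) d′≡p^1+k) (*-comm _ p))

vertex⇒0<n : Vertex n d → 0 < n
vertex⇒0<n (_ , 1<d , d<n) = <-trans (<-trans z<s 1<d) d<n

vertex-of-factor : 1 < d → 1 < k → n ≡ d * k → Vertex n d
vertex-of-factor {d} {k} 1<d 1<k refl = m∣m*n k , 1<d , m<m*n d k {{>-nonZero (<-trans z<s 1<d)}} 1<k

vertex-∣ : Vertex n c → d ∣ c → 1 < d → Vertex n d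
vertex-∣ (c∣n , 1<c , c<n) d∣c 1<d =
  ∣-trans d∣c c∣n , 1<d , ≤-<-trans (∣⇒≤ {{>-nonZero (<-trans z<s 1<c)}} d∣c) c<n

∈-sum-of-∣ : 0 < n → x < n → u ∣ x ⊎ v ∣ x → SumZ n (IdealGen u) (IdealGen v) x
∈-sum-of-∣ {v = v} 0<n x<n (inj₁ u∣x) = _ , 0 , 0 , x<n , 0<n , u∣x , v ∣0 , refl
∈-sum-of-∣ {x = x} {u = u} 0<n x<n (inj₂ v∣x) = 0 , x , 0 , 0<n , x<n , u ∣0 , v∣x , sym (+-identityʳ x)

UnionEssential : ℕ → ℕ → ℕ → Set
UnionEssential n u v = ∀ e → ProperDivisor n e → ∃[ x ] (ProperDivisor n x × e ∣ x × (u ∣ x ⊎ v ∣ x))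

adj-of-unionEssential : Vertex n u → Vertex n v → u ≢ v → UnionEssential n u v → Adj n u v
adj-of-unionEssential {n = n} {u = u} {v = v} vu vv u≢v union-essential = vu , vv , u≢v , essential
  where
  0<n : 0 < n
  0<n = vertex⇒0<n vu
  essential : Essential n (SumZ n (IdealGen u) (IdealGen v))
  essential e e∣n e≢n with union-essential e (e∣n , e≢n)
  ... | x , x-proper , e∣x , u∣x⊎v∣x =
    let x<n , x≢0 = properDivisor⇒bounds 0<n x-proper in x , x<n , x≢0 , ∈-sum-of-∣ 0<n x<n u∣x⊎v∣x , e∣x

¬adj-of-coprime-factor : n ≡ g * e → Coprime g e → 1 < g → g ∣ u → g ∣ v → ¬ Adj n u v
¬adj-of-coprime-factor {g = g} {e = e} refl g⊥e 1<g g∣u g∣v (vu , _ , _ , essential) =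
  let e∣n , e≢n = cofactor-properDivisor 1<g refl (vertex⇒0<n vu)
      x , x<n , x≢0 , (a , b , q , _ , _ , u∣a , v∣b , a+b≡x+qn) , e∣x = essential e e∣n e≢n
      g∣qn+x : g ∣ q * (g * e) + x
      g∣qn+x = subst (g ∣_) (trans a+b≡x+qn (+-comm x _)) (∣m∣n⇒∣m+n (∣-trans g∣u u∣a) (∣-trans g∣v v∣b))
      g∣x : g ∣ x
      g∣x = ∣m+n∣m⇒∣n g∣qn+x (∣n⇒∣m*n q (m∣m*n e))
  in <⇒≱ x<n (∣⇒≤ {{≢-nonZero x≢0}} (coprime⇒*∣ g⊥e g∣x e∣x))

prime-adj-of-p²∣n : Prime p → p * p ∣ n → Vertex n p → Vertex n u → p ≢ u → Adj n p u
prime-adj-of-p²∣n {p = p} {n = n} {u = u} p-prime p²∣n vp vu p≢u =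
  adj-of-unionEssential vp vu p≢u union-essential
  where
  instance _ = prime⇒nonZero p-prime
  union-essential : UnionEssential n p u
  union-essential e e-proper@(e∣n , _) with p ∣? e
  ... | yes p∣e = e , e-proper , ∣-refl , inj₁ p∣e
  ... | no p∤e = e * p , (ep∣n , ep≢n) , m∣m*n p , inj₁ (n∣m*n e)
    where
    ep∣n : e * p ∣ n
    ep∣n = coprime⇒*∣ (Coprime.sym (prime∤⇒coprime p-prime p∤e)) e∣n (proj₁ vp)
    ep≢n : e * p ≢ n
    ep≢n ep≡n = p∤e (*-cancelʳ-∣ p (subst (p * p ∣_) (sym ep≡n) p²∣n))

prime-adj-of-∣cofactor : Prime p → n ≡ p * m → Vertex n p → Vertex n u → p ≢ u → u ∣ m → Adj n p u
prime-adj-of-∣cofactor {p} {m = m} {u = u} p-prime refl vp vu p≢u u∣m =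
  adj-of-unionEssential vp vu p≢u union-essential
  where
  union-essential : UnionEssential (p * m) p u
  union-essential e e-proper@(e∣n , _) with p ∣? e
  ... | yes p∣e = e , e-proper , ∣-refl , inj₁ p∣e
  ... | no p∤e = m , cofactor-properDivisor (prime>1 p-prime) refl (vertex⇒0<n vp) ,
                 ∣p*m∧p∤⇒∣m p-prime p∤e e∣n , inj₂ u∣m

cofactor-adj-p*q : Prime p → Prime q → n ≡ p * (q * t) → Vertex n t → Vertex n (p * q) → t ≢ p * q →
  Adj n t (p * q)
cofactor-adj-p*q {p = p} {q = q} {t = t} p-prime q-prime refl vt vpq t≢pq =
  adj-of-unionEssential vt vpq t≢pq union-essential
  where
  instance _ = prime⇒nonZero p-prime
  0<n : 0 < p * (q * t)
  0<n = vertex⇒0<n vt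
  n≡q*[t*p] : p * (q * t) ≡ q * (t * p)
  n≡q*[t*p] = trans (*-comm p (q * t)) (*-assoc q t p)
  union-essential : UnionEssential (p * (q * t)) t (p * q)
  union-essential e e-proper@(e∣n , _) with p ∣? e
  ... | no p∤e = q * t , cofactor-properDivisor (prime>1 p-prime) refl 0<n ,
                 ∣p*m∧p∤⇒∣m p-prime p∤e e∣n , inj₁ (n∣m*n q)
  ... | yes (divides e′ refl) with q ∣? e′
  ...   | yes q∣e′ = e′ * p , e-proper , ∣-refl , inj₂ (subst (_∣ e′ * p) (*-comm q p) (*-pres-∣ q∣e′ ∣-refl))
  ...   | no q∤e′ =
    t * p , cofactor-properDivisor (prime>1 q-prime) n≡q*[t*p] 0<n , *-monoˡ-∣ p e′∣t , inj₁ (m∣m*n p)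
    where
    e′∣t : e′ ∣ t
    e′∣t = ∣p*m∧p∤⇒∣m q-prime q∤e′ (*-cancelʳ-∣ p (subst (e′ * p ∣_) (*-comm p (q * t)) e∣n))

-- Complete graphs: n = p^(1+k) and n = p q

primePower-complete : Prime p → ∀ k → Complete (p ^ suc k)
primePower-complete {p} p-prime k vu@(u∣n , _ , u<n) vv u≢v =
  adj-of-unionEssential vu vv u≢v λ e e-proper →
    p ^ k , p^k-proper , properDivisor-p^1+k⇒∣p^k p-prime k e-proper ,
    inj₁ (properDivisor-p^1+k⇒∣p^k p-prime k (u∣n , <⇒≢ u<n))
  where
  p^k-proper : ProperDivisor (p ^ suc k) (p ^ k)
  p^k-proper = cofactor-properDivisor (prime>1 p-prime) refl (vertex⇒0<n vu)

vertex-of-p*q : Prime p → Prime q → Vertex (p * q) d → d ≡ p ⊎ d ≡ q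
vertex-of-p*q {p} {q} {d} p-prime q-prime (d∣pq , 1<d , d<pq) with p ∣? d
... | no p∤d with prime⇒irreducible q-prime (∣p*m∧p∤⇒∣m p-prime p∤d d∣pq)
...   | inj₁ refl = ⊥-elim (<-irrefl refl 1<d)
...   | inj₂ d≡q = inj₂ d≡q
vertex-of-p*q {p} {q} p-prime q-prime (d∣pq , 1<d , d<pq) | yes (divides d′ refl)
  with prime⇒irreducible q-prime
         (*-cancelʳ-∣ {m = d′} p {{prime⇒nonZero p-prime}} (subst (d′ * p ∣_) (*-comm p q) d∣pq))
... | inj₁ refl = inj₁ (*-identityˡ p)
... | inj₂ refl = ⊥-elim (<⇒≢ d<pq (*-comm q p))

twoPrimes-complete : Prime p → Prime q → p ≢ q → Complete (p * q)
twoPrimes-complete {p} {q} p-prime q-prime p≢q {u} {v} vu vv u≢v =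
  adj-of-cases (vertex-of-p*q p-prime q-prime vu) (vertex-of-p*q p-prime q-prime vv)
  where
  adj-of-cases : u ≡ p ⊎ u ≡ q → v ≡ p ⊎ v ≡ q → Adj (p * q) u v
  adj-of-cases (inj₁ refl) (inj₁ refl) = ⊥-elim (u≢v refl)
  adj-of-cases (inj₁ refl) (inj₂ refl) = prime-adj-of-∣cofactor p-prime refl vu vv u≢v ∣-refl
  adj-of-cases (inj₂ refl) (inj₁ refl) = adj-sym (prime-adj-of-∣cofactor p-prime refl vv vu (u≢v ∘ sym) ∣-refl)
  adj-of-cases (inj₂ refl) (inj₂ refl) = ⊥-elim (u≢v refl)

primePowerOrTwoPrimes⇒complete : PrimePowerOrTwoPrimes n → Complete n
primePowerOrTwoPrimes⇒complete (inj₁ (p , suc k , p-prime , _ , refl)) = primePower-complete p-prime k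
primePowerOrTwoPrimes⇒complete (inj₂ (p , q , p-prime , q-prime , p≢q , refl)) =
  twoPrimes-complete p-prime q-prime p≢q

-- Induced paths for the remaining composites

SquareTimesCoprime : ℕ → Set
SquareTimesCoprime n = ∃[ p ] ∃[ a ] ∃[ s ] (Prime p × ¬ p ∣ s × 1 < s × n ≡ p ^ (2 + a) * s)

PrimeTimesCoprimeComposite : ℕ → Set
PrimeTimesCoprimeComposite n =
  ∃[ p ] ∃[ q ] ∃[ t ] (Prime p × Prime q × ¬ p ∣ q * t × 1 < t × n ≡ p * (q * t))

squareTimesCoprime⇒¬metricDim : SquareTimesCoprime n → ¬ MetricDim n (VertexCount n ∸ 1)
squareTimesCoprime⇒¬metricDim {n} (p , a , s , p-prime , p∤s , 1<s , n≡p^[2+a]*s) =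
  induced-path⇒¬metricDim (prime-adj-of-p²∣n p-prime p²∣n vp vs (∤⇒≢ p∤s))
    (prime-adj-of-p²∣n p-prime p²∣n vp vps p≢ps)
    (¬adj-of-coprime-factor n≡s*p^[2+a] s⊥p^[2+a] 1<s ∣-refl (n∣m*n p)) s≢ps
  where
  instance
    _ = prime⇒nonZero p-prime
    _ = >-nonZero (<-trans z<s 1<s)
    _ = m^n≢0 p a
  1<p : 1 < p
  1<p = prime>1 p-prime
  rearrange : ∀ p r s → p * r * s ≡ p * s * r
  rearrange = solve-∀
  vps : Vertex n (p * s)
  vps = vertex-of-factor (≤-trans 1<p (m≤m*n p s)) (≤-trans 1<p (m≤m*n p (p ^ a)))
          (trans n≡p^[2+a]*s (rearrange p (p * p ^ a) s))
  vp : Vertex n p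
  vp = vertex-∣ vps (m∣m*n s) 1<p
  vs : Vertex n s
  vs = vertex-∣ vps (n∣m*n p) 1<s
  p²∣n : p * p ∣ n
  p²∣n = subst (p * p ∣_) (sym n≡p^[2+a]*s) (∣m⇒∣m*n s (*-monoʳ-∣ p (m∣m*n (p ^ a))))
  n≡s*p^[2+a] : n ≡ s * p ^ (2 + a)
  n≡s*p^[2+a] = trans n≡p^[2+a]*s (*-comm _ s)
  s⊥p^[2+a] : Coprime s (p ^ (2 + a))
  s⊥p^[2+a] = Coprime.sym (coprime-^ˡ (2 + a) (prime∤⇒coprime p-prime p∤s))
  p≢ps : p ≢ p * s
  p≢ps = <⇒≢ (m<m*n p s 1<s)
  s≢ps : s ≢ p * s
  s≢ps s≡ps = p∤s (subst (p ∣_) (sym s≡ps) (m∣m*n s))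

primeTimesCoprimeComposite⇒¬metricDim : PrimeTimesCoprimeComposite n → ¬ MetricDim n (VertexCount n ∸ 1)
primeTimesCoprimeComposite⇒¬metricDim {n} (p , q , t , p-prime , q-prime , p∤qt , 1<t , n≡p*[q*t]) =
  induced-path⇒¬metricDim (adj-sym (prime-adj-of-∣cofactor p-prime n≡p*[q*t] vp vt p≢t (n∣m*n q)))
    (cofactor-adj-p*q p-prime q-prime n≡p*[q*t] vt vpq t≢pq)
    (¬adj-of-coprime-factor n≡p*[q*t] (prime∤⇒coprime p-prime p∤qt) 1<p ∣-refl (m∣m*n q)) p≢pq
  where
  instance
    _ = prime⇒nonZero p-prime
    _ = prime⇒nonZero q-prime
  1<p : 1 < p
  1<p = prime>1 p-prime
  1<pq : 1 < p * q
  1<pq = ≤-trans 1<p (m≤m*n p q)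
  vpq : Vertex n (p * q)
  vpq = vertex-of-factor 1<pq 1<t (trans n≡p*[q*t] (sym (*-assoc p q t)))
  vp : Vertex n p
  vp = vertex-∣ vpq (m∣m*n q) 1<p
  vt : Vertex n t
  vt = vertex-of-factor 1<t 1<pq (trans n≡p*[q*t] (trans (sym (*-assoc p q t)) (*-comm (p * q) t)))
  p≢t : p ≢ t
  p≢t p≡t = p∤qt (∣n⇒∣m*n q (subst (p ∣_) p≡t ∣-refl))
  t≢pq : t ≢ p * q
  t≢pq t≡pq = p∤qt (∣n⇒∣m*n q (subst (p ∣_) (sym t≡pq) (m∣m*n q)))
  p≢pq : p ≢ p * q
  p≢pq = <⇒≢ (m<m*n p q (prime>1 q-prime))

-- Classification of composite numbers

CompositeShape : ℕ → Set
CompositeShape n = PrimePowerOrTwoPrimes n ⊎ SquareTimesCoprime n ⊎ PrimeTimesCoprimeComposite n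

prime*coprime-shape : Prime p → ¬ p ∣ s → 1 < s → n ≡ p * s → CompositeShape n
prime*coprime-shape {p} {s} p-prime p∤s 1<s n≡p*s with prime⊎prime*nontrivial 1<s
... | inj₁ s-prime = inj₁ (inj₂ (p , s , p-prime , s-prime , ∤⇒≢ p∤s , n≡p*s))
... | inj₂ (q , t , q-prime , 1<t , s≡q*t) =
  let p∤qt = subst (¬_ ∘ (p ∣_)) s≡q*t p∤s
  in inj₂ (inj₂ (p , q , t , p-prime , q-prime , p∤qt , 1<t , trans n≡p*s (cong (p *_) s≡q*t)))

composite-shape : Composite n → CompositeShape n
composite-shape {n} n-composite with primeDivisor (nonTrivial⇒n>1 n {{composite⇒nonTrivial n-composite}})
... | p , p-prime , p∣n with p-adic-split p-prime n (>-nonZero⁻¹ n {{composite⇒nonZero n-composite}})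
...   | zero , s , n≡1*s , p∤s = ⊥-elim (p∤s (subst (p ∣_) (trans n≡1*s (*-identityˡ s)) p∣n))
...   | a , zero , n≡p^a*0 , _ =
  ⊥-elim (≢-nonZero⁻¹ n {{composite⇒nonZero n-composite}} (trans n≡p^a*0 (*-zeroʳ (p ^ a))))
...   | 1 , 1 , n≡p*1*1 , _ =
  let n≡p = trans n≡p*1*1 (trans (*-identityʳ (p * 1)) (*-identityʳ p))
  in ⊥-elim (composite⇒¬prime n-composite (subst Prime (sym n≡p) p-prime))
...   | suc (suc a) , 1 , n≡p^[2+a]*1 , _ =
  inj₁ (inj₁ (p , 2 + a , p-prime , s≤s (s≤s z≤n) , trans n≡p^[2+a]*1 (*-identityʳ _)))
...   | suc (suc a) , s@(suc (suc _)) , n≡p^[2+a]*s , p∤s =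
  inj₂ (inj₁ (p , a , s , p-prime , p∤s , s≤s (s≤s z≤n) , n≡p^[2+a]*s))
...   | 1 , s@(suc (suc _)) , n≡p*1*s , p∤s =
  prime*coprime-shape p-prime p∤s (s≤s (s≤s z≤n)) (trans n≡p*1*s (cong (_* s) (*-identityʳ p)))

-- Composite n already forces 4 ≤ n.
mainTheorem7 : ∀ n → 4 ≤ n → Composite n →
    (MetricDim n (VertexCount n ∸ 1) ⇔ PrimePowerOrTwoPrimes n)
mainTheorem7 n _ n-composite = mk⇔ shape-of-metricDim (complete⇒metricDim ∘ primePowerOrTwoPrimes⇒complete)
  where
  shape-of-metricDim : MetricDim n (VertexCount n ∸ 1) → PrimePowerOrTwoPrimes n
  shape-of-metricDim dim with composite-shape n-composite
  ... | inj₁ shape = shape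
  ... | inj₂ (inj₁ shape) = ⊥-elim (squareTimesCoprime⇒¬metricDim shape dim)
  ... | inj₂ (inj₂ shape) = ⊥-elim (primeTimesCoprimeComposite⇒¬metricDim shape dim)
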